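{- Let $G$ be a connected graph, let $T$ be a cutset of $G$, and let $A_1,\dots,A_k$ be the components of $G-T$. (a) If $k\ge |T|+2$, then $G$ is not traceable. (b) If $G$ is maximal nontraceable, then $k\le |T|+2$. (c) If $G$ is maximal nontraceable and $k=|T|+2$, then the subgraph of $G$ induced by $T\cup V(A_i)$ is complete for each $i=1,\dots,k$.
   Context: Graphs are simple and finite. A cutset of a connected graph $G$ is a set $T\subseteq V(G)$ such that $G-T$ is disconnected. A graph is traceable if it has a hamiltonian path. A graph $G$ is maximal nontraceable if $G$ is not traceable but $G+e$ is traceable for every pair of nonadjacent vertices joined by a new edge $e$. -}

module Defs where

open import Data.Nat using (ℕ; suc; _+_; _≥_; _≤_)
open import Data.Bool using (Bool; true; false; _∨_; _∧_; T)
open import Data.Fin using (Fin; toℕ)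
open import Data.Fin.Subset using (Subset; _∈_; _∉_; ∣_∣; ⊤)
open import Data.Product using (Σ; ∃; _×_; _,_)
open import Data.Sum using (_⊎_)
open import Relation.Nullary using (¬_; does)
open import Relation.Binary.PropositionalEquality using (_≡_; _≢_)
open import Function.Bundles using (_⇔_)
open import Function.Definitions using (Injective)
import Data.Fin as F

record Graph (n : ℕ) : Set where
  field
    adj   : Fin n → Fin n → Bool
    sym   : ∀ x y → adj x y ≡ adj y x
    irrefl : ∀ x → adj x x ≡ false

open Graph public

Adj : ∀ {n} → Graph n → Fin n → Fin n → Set
Adj G x y = T (adj G x y)

addEdge : ∀ {n} (G : Graph n) (u v : Fin n) → u ≢ v → Graph n
addEdge {n} G u v u≢v = record
  { adj = a
  ; sym = λ x y → symA x y
  ; irrefl = irr }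
  where
  open import Data.Bool.Properties using (∨-comm; ∨-assoc)
  open import Relation.Binary.PropositionalEquality using (refl; cong₂; cong)
  open import Relation.Nullary using (yes; no)
  open import Data.Empty using (⊥-elim)
  e : Fin n → Fin n → Bool
  e x y = (does (x F.≟ u) ∧ does (y F.≟ v)) ∨ (does (x F.≟ v) ∧ does (y F.≟ u))
  a : Fin n → Fin n → Bool
  a x y = adj G x y ∨ e x y
  esym : ∀ x y → e x y ≡ e y x
  esym x y with x F.≟ u | y F.≟ v | x F.≟ v | y F.≟ u
  ... | yes _ | yes _ | yes _ | yes _ = refl
  ... | yes _ | yes _ | yes _ | no _ = refl
  ... | yes _ | yes _ | no _ | yes _ = refl
  ... | yes _ | yes _ | no _ | no _ = refl
  ... | yes _ | no _ | yes _ | yes _ = refl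
  ... | yes _ | no _ | yes _ | no _ = refl
  ... | yes _ | no _ | no _ | yes _ = refl
  ... | yes _ | no _ | no _ | no _ = refl
  ... | no _ | yes _ | yes _ | yes _ = refl
  ... | no _ | yes _ | yes _ | no _ = refl
  ... | no _ | yes _ | no _ | yes _ = refl
  ... | no _ | yes _ | no _ | no _ = refl
  ... | no _ | no _ | yes _ | yes _ = refl
  ... | no _ | no _ | yes _ | no _ = refl
  ... | no _ | no _ | no _ | yes _ = refl
  ... | no _ | no _ | no _ | no _ = refl
  symA : ∀ x y → a x y ≡ a y x
  symA x y = cong₂ _∨_ (Graph.sym G x y) (esym x y)
  eirr : ∀ x → e x x ≡ false
  eirr x with x F.≟ u | x F.≟ v
  ... | yes refl | yes refl = ⊥-elim (u≢v refl)
  ... | yes _ | no _ = refl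
  ... | no _ | yes _ = refl
  ... | no _ | no _ = refl
  irr : ∀ x → a x x ≡ false
  irr x rewrite Graph.irrefl G x | eirr x = refl

data Conn {n} (G : Graph n) (S : Subset n) : Fin n → Fin n → Set where
  here : ∀ {u} → u ∈ S → Conn G S u u
  step : ∀ {u w v} → u ∈ S → Adj G u w → Conn G S w v → Conn G S u v

Connected : ∀ {n} → Graph n → Set
Connected G = ∀ u v → Conn G ⊤ u v

open import Data.Fin.Subset using (∁) public

Cutset : ∀ {n} → Graph n → Subset n → Set
Cutset G T' = Σ _ λ u → Σ _ λ v → u ∉ T' × v ∉ T' × ¬ Conn G (∁ T') u v

-- c labels the vertices of G - T by Fin k so that the label classes
-- are exactly the components A_1 .. A_k of G - T.
IsComponentLabelling : ∀ {n} (G : Graph n) (T' : Subset n) (k : ℕ)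
  → ((v : Fin n) → v ∉ T' → Fin k) → Set
IsComponentLabelling {n} G T' k c =
  (∀ i → Σ (Fin n) λ v → Σ (v ∉ T') λ hv → c v hv ≡ i)
  × (∀ u v (hu : u ∉ T') (hv : v ∉ T') → (c u hu ≡ c v hv) ⇔ Conn G (∁ T') u v)

-- Hamiltonian path: an injective (hence bijective) ordering p of all
-- vertices with consecutive vertices adjacent.
Traceable : ∀ {n} → Graph n → Set
Traceable {n} G = Σ (Fin n → Fin n) λ p →
  Injective _≡_ _≡_ p × (∀ i j → toℕ j ≡ suc (toℕ i) → Adj G (p i) (p j))

MaximalNontraceable : ∀ {n} → Graph n → Set
MaximalNontraceable G =
  ¬ Traceable G × (∀ u v (u≢v : u ≢ v) → adj G u v ≡ false → Traceable (addEdge G u v u≢v))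

{-# OPTIONS --safe #-}
-- Follow a hamiltonian path and, for each component A_i, look at the vertex just before the
-- path first enters A_i: there is none (the path starts in A_i), or it lies in T, or it lies
-- in another component, the path stepping from one component to another. Distinct components
-- give distinct such witnesses, so k ≤ 1 + |T| + (number of steps between components).
-- A path in G itself never steps between components, which gives (a). If G is maximal
-- nontraceable, G + uv is traceable for u, v in different components, and its path steps
-- between components only along uv, hence at most once: (b). For (c), a missing edge xy
-- inside T ∪ A_i could be added without creating an edge between components, so the
-- traceable graph G + xy would still satisfy k ≤ |T| + 1.
module Submission where

open import Defs hiding (sym)
open import Data.Nat using (ℕ; _+_; _≥_; _≤_; _<_; suc)
open import Data.Nat.Properties using (≤-refl; ≤-reflexive; ≤-trans; <-asym; <⇒≱; 1+n≰n; +-suc; +-monoʳ-<)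
open import Data.Bool using (true; false; T; _∧_)
open import Data.Bool.Properties using (T-∨; T-∧; T-≡; ¬-not; T?)
open import Data.Fin using (Fin; Fin′; zero; suc; toℕ; inject; inject₁; fromℕ<; join; splitAt; punchOut)
open import Data.Fin.Properties
  using ( suc-injective; toℕ-injective; toℕ-inject; toℕ-inject₁; toℕ-fromℕ<; splitAt-join
        ; injective⇒≤; punchOut-injective; any?; ¬∀⟶∃¬-smallest)
  renaming (_≟_ to _≟ᶠ_)
open import Data.Fin.Subset using (Subset; _∈_; _∉_; ∣_∣; ∁)
open import Data.Fin.Subset.Properties using (_∈?_; x∉p⇒x∈∁p)
open import Data.Maybe using (Maybe; just; nothing)
open import Data.Maybe.Properties using (just-injective) renaming (≡-dec to ≡-decᵐ)
open import Data.Vec using (here; there)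
open import Data.Product using (Σ; ∃; ∃₂; _×_; _,_; proj₁; proj₂)
open import Data.Sum using (_⊎_; inj₁; inj₂)
import Data.Sum as Sum
open import Data.Sum.Properties using (inj₁-injective; inj₂-injective)
open import Data.Empty using (⊥-elim)
open import Function using (_∘_; id)
open import Function.Bundles using (Equivalence)
open import Function.Definitions using (Injective)
open import Relation.Nullary using (¬_; Dec; yes; no; does; ¬?; contradiction)
open import Relation.Nullary.Decidable using (decidable-stable)
open import Relation.Binary.PropositionalEquality using (_≡_; _≢_; refl; sym; trans; cong; subst; subst₂)

open Equivalence using (to; from)

private
  variable
    n k : ℕ

witness : ∀ {A : Set} (a? : Dec A) → T (does a?) → A
witness (yes a) _ = a

injective⇒surjective : {f : Fin n → Fin n} → Injective _≡_ _≡_ f → ∀ y → ∃ λ x → f x ≡ y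
injective⇒surjective {suc _} {f} f-inj y with any? (λ x → f x ≟ᶠ y)
... | yes hit = hit
... | no miss = contradiction (injective⇒≤ punchOut-f-injective) 1+n≰n
  where
  f≢y : ∀ x → y ≢ f x
  f≢y x e = miss (x , sym e)
  punchOut-f-injective : Injective _≡_ _≡_ (λ x → punchOut (f≢y x))
  punchOut-f-injective e = f-inj (punchOut-injective (f≢y _) (f≢y _) e)

join-injective : ∀ m n {x y : Fin m ⊎ Fin n} → join m n x ≡ join m n y → x ≡ y
join-injective m n {x} {y} e =
  trans (sym (splitAt-join m n x)) (trans (cong (splitAt m) e) (splitAt-join m n y))

∈-index : {S : Subset n} {x : Fin n} → x ∈ S → Fin ∣ S ∣
∈-index here = zero
∈-index (there {y = true} x∈S) = suc (∈-index x∈S)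
∈-index (there {y = false} x∈S) = ∈-index x∈S

∈-index-injective : {S : Subset n} {x y : Fin n} (x∈S : x ∈ S) (y∈S : y ∈ S) →
                    ∈-index x∈S ≡ ∈-index y∈S → x ≡ y
∈-index-injective here here _ = refl
∈-index-injective here (there {y = true} _) ()
∈-index-injective (there {y = true} _) here ()
∈-index-injective (there {y = true} x∈S) (there y∈S) e =
  cong suc (∈-index-injective x∈S y∈S (suc-injective e))
∈-index-injective (there {y = false} x∈S) (there y∈S) e = cong suc (∈-index-injective x∈S y∈S e)

Step : Fin n → Fin n → Set
Step q j = toℕ j ≡ suc (toℕ q)

start⊎step : (j : Fin n) → toℕ j ≡ 0 ⊎ ∃ λ q → Step q j
start⊎step zero = inj₁ refl
start⊎step (suc j) = inj₂ (inject₁ j , cong suc (sym (toℕ-inject₁ j)))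

SamePair : Fin n → Fin n → Fin n → Fin n → Set
SamePair x y u v = (x ≡ u × y ≡ v) ⊎ (x ≡ v × y ≡ u)

step-asym : {q j : Fin n} → Step q j → ¬ Step j q
step-asym s s′ = <-asym (≤-reflexive (sym s)) (≤-reflexive (sym s′))

injective-step-unique : {p : Fin n → Fin n} → Injective _≡_ _≡_ p →
  ∀ {q j q′ j′ u v} → Step q j → Step q′ j′ →
  SamePair (p q) (p j) u v → SamePair (p q′) (p j′) u v → q ≡ q′
injective-step-unique p-inj s s′ (inj₁ (refl , refl)) (inj₁ (e , _)) = p-inj (sym e)
injective-step-unique p-inj s s′ (inj₂ (refl , refl)) (inj₂ (e , _)) = p-inj (sym e)
injective-step-unique p-inj s s′ (inj₁ (refl , refl)) (inj₂ (e , e′)) =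
  ⊥-elim (step-asym s (subst₂ Step (p-inj e) (p-inj e′) s′))
injective-step-unique p-inj s s′ (inj₂ (refl , refl)) (inj₁ (e , e′)) =
  ⊥-elim (step-asym s (subst₂ Step (p-inj e) (p-inj e′) s′))

addEdge-adj : (G : Graph n) {u v : Fin n} (u≢v : u ≢ v) {x y : Fin n} →
              Adj (addEdge G u v u≢v) x y → Adj G x y ⊎ SamePair x y u v
addEdge-adj G {u} {v} _ {x} {y} a =
  Sum.map₂ (Sum.map (both (x ≟ᶠ u) (y ≟ᶠ v)) (both (x ≟ᶠ v) (y ≟ᶠ u)) ∘ to T-∨) (to T-∨ a)
  where
  both : ∀ {A B : Set} (a? : Dec A) (b? : Dec B) → T (does a? ∧ does b?) → A × B
  both a? b? t = witness a? (proj₁ (to T-∧ t)) , witness b? (proj₂ (to T-∧ t))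

-- ℓ v ≡ just i encodes v ∈ A_i; the vertices of T are left unlabelled.
LabelChange : (Fin n → Maybe (Fin k)) → Fin n → Fin n → Set
LabelChange ℓ x y = ∃₂ λ i j → ℓ x ≡ just i × ℓ y ≡ just j × i ≢ j

RespectsLabels : Graph n → (Fin n → Maybe (Fin k)) → Set
RespectsLabels H ℓ = ∀ {x y} → Adj H x y → ¬ LabelChange ℓ x y

module _ (G : Graph n) (ℓ : Fin n → Maybe (Fin k)) (resp : RespectsLabels G ℓ)
         {u v : Fin n} (u≢v : u ≢ v) where

  addEdge-labelChange : ∀ {x y} → Adj (addEdge G u v u≢v) x y → LabelChange ℓ x y → SamePair x y u v
  addEdge-labelChange a ch = Sum.[ (λ a′ → ⊥-elim (resp a′ ch)) , id ] (addEdge-adj G u≢v a)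

  addEdge-respectsLabels : (i : Fin k) → (∀ {j} → ℓ u ≡ just j → j ≡ i) → (∀ {j} → ℓ v ≡ just j → j ≡ i) →
                           RespectsLabels (addEdge G u v u≢v) ℓ
  addEdge-respectsLabels i ℓu ℓv a ch@(j , j′ , ℓx , ℓy , j≢j′) with addEdge-labelChange a ch
  ... | inj₁ (refl , refl) = j≢j′ (trans (ℓu ℓx) (sym (ℓv ℓy)))
  ... | inj₂ (refl , refl) = j≢j′ (trans (ℓv ℓx) (sym (ℓu ℓy)))

module FirstVisits (ℓ : Fin n → Maybe (Fin k)) (p : Fin n → Fin n)
                   (visited : ∀ i → ∃ λ j → ℓ (p j) ≡ just i) where

  private
    _≟_ : (a b : Maybe (Fin k)) → Dec (a ≡ b)
    _≟_ = ≡-decᵐ _≟ᶠ_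

    firstVisit : ∀ i → ∃ λ j → ¬ ℓ (p j) ≢ just i × ((q : Fin′ j) → ℓ (p (inject q)) ≢ just i)
    firstVisit i = ¬∀⟶∃¬-smallest _ (λ j → ℓ (p j) ≢ just i) (λ j → ¬? (ℓ (p j) ≟ just i))
                     (λ never → never (proj₁ (visited i)) (proj₂ (visited i)))

  first : Fin k → Fin n
  first i = proj₁ (firstVisit i)

  ℓ-first : ∀ i → ℓ (p (first i)) ≡ just i
  ℓ-first i = decidable-stable (ℓ (p (first i)) ≟ just i) (proj₁ (proj₂ (firstVisit i)))

  ℓ-before-first : ∀ {i} q → toℕ q < toℕ (first i) → ℓ (p q) ≢ just i
  ℓ-before-first {i} q q<first =
    subst (λ r → ℓ (p r) ≢ just i) inject-q (proj₂ (proj₂ (firstVisit i)) q′)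
    where
    q′ : Fin′ (first i)
    q′ = fromℕ< q<first
    inject-q : inject q′ ≡ q
    inject-q = toℕ-injective (trans (toℕ-inject q′) (toℕ-fromℕ< q<first))

  first-injective : ∀ {i i′} → first i ≡ first i′ → i ≡ i′
  first-injective {i} {i′} e =
    just-injective (trans (sym (ℓ-first i)) (trans (cong (ℓ ∘ p) e) (ℓ-first i′)))

  first-step-injective : ∀ {i i′ q q′} → Step q (first i) → Step q′ (first i′) → q ≡ q′ → i ≡ i′
  first-step-injective s s′ refl = first-injective (toℕ-injective (trans s (sym s′)))

  data Entry (i : Fin k) : Set where
    atStart         : toℕ (first i) ≡ 0 → Entry i
    afterUnlabelled : ∀ q → Step q (first i) → ℓ (p q) ≡ nothing → Entry i
    afterChange     : ∀ q → Step q (first i) → LabelChange ℓ (p q) (p (first i)) → Entry i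

  entry : ∀ i → Entry i
  entry i with start⊎step (first i)
  ... | inj₁ z = atStart z
  ... | inj₂ (q , s) with ℓ (p q) in ℓpq
  ...   | nothing = afterUnlabelled q s ℓpq
  ...   | just i′ = afterChange q s (i′ , i , ℓpq , ℓ-first i , i′≢i)
    where
    i′≢i : i′ ≢ i
    i′≢i refl = ℓ-before-first q (≤-reflexive (sym s)) ℓpq

module LabelCount (T : Subset n) (ℓ : Fin n → Maybe (Fin k))
                  (unlabelled⇒∈ : ∀ {v} → ℓ v ≡ nothing → v ∈ T)
         (ℓ-surjective : ∀ i → ∃ λ v → ℓ v ≡ just i) where

  ChangeAt : (Fin n → Fin n) → Fin n → Set
  ChangeAt p q = ∃ λ j → Step q j × LabelChange ℓ (p q) (p j)

  labels≤1+∣T∣+changes : ∀ {b} {p : Fin n → Fin n} → Injective _≡_ _≡_ p →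
    (count : ∀ q → ChangeAt p q → Fin b) →
    (∀ {q q′} ch ch′ → count q ch ≡ count q′ ch′ → q ≡ q′) →
    k ≤ suc (∣ T ∣ + b)
  labels≤1+∣T∣+changes {b} {p} p-inj count count-inj =
    injective⇒≤ {f = join (suc ∣ T ∣) b ∘ code ∘ entry}
      (λ e → code-injective (entry _) (entry _) (join-injective (suc ∣ T ∣) b e))
    where
    visited : ∀ i → ∃ λ j → ℓ (p j) ≡ just i
    visited i = let v , ℓv≡i = ℓ-surjective i
                    j , pj≡v = injective⇒surjective p-inj v
                in j , trans (cong ℓ pj≡v) ℓv≡i

    open FirstVisits ℓ p visited

    code : ∀ {i} → Entry i → Fin (suc ∣ T ∣) ⊎ Fin b
    code (atStart _) = inj₁ zero
    code (afterUnlabelled _ _ ℓpq) = inj₁ (suc (∈-index (unlabelled⇒∈ ℓpq)))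
    code (afterChange q s ch) = inj₂ (count q (_ , s , ch))

    code-injective : ∀ {i i′} (e : Entry i) (e′ : Entry i′) → code e ≡ code e′ → i ≡ i′
    code-injective (atStart z) (atStart z′) _ = first-injective (toℕ-injective (trans z (sym z′)))
    code-injective (afterUnlabelled _ s ℓpq) (afterUnlabelled _ s′ ℓpq′) e =
      first-step-injective s s′ (p-inj (∈-index-injective (unlabelled⇒∈ ℓpq) (unlabelled⇒∈ ℓpq′)
                                          (suc-injective (inj₁-injective e))))
    code-injective (afterChange _ s _) (afterChange _ s′ _) e =
      first-step-injective s s′ (count-inj _ _ (inj₂-injective e))
    code-injective (atStart _) (afterUnlabelled _ _ _) ()
    code-injective (atStart _) (afterChange _ _ _) ()
    code-injective (afterUnlabelled _ _ _) (atStart _) ()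
    code-injective (afterUnlabelled _ _ _) (afterChange _ _ _) ()
    code-injective (afterChange _ _ _) (atStart _) ()
    code-injective (afterChange _ _ _) (afterUnlabelled _ _ _) ()

  traceable⇒labels≤∣T∣+1 : (H : Graph n) → RespectsLabels H ℓ → Traceable H → k ≤ ∣ T ∣ + 1
  traceable⇒labels≤∣T∣+1 _ resp (p , p-inj , p-adj) =
    ≤-trans (labels≤1+∣T∣+changes p-inj (λ q ch → ⊥-elim (noChange q ch))
                                        (λ ch _ _ → ⊥-elim (noChange _ ch)))
            (≤-reflexive (sym (+-suc ∣ T ∣ 0)))
    where
    noChange : ∀ q → ¬ ChangeAt p q
    noChange q (j , s , ch) = resp (p-adj q j s) ch

  labels≥∣T∣+2⇒¬traceable : k ≥ ∣ T ∣ + 2 → (H : Graph n) → RespectsLabels H ℓ → ¬ Traceable H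
  labels≥∣T∣+2⇒¬traceable k≥ H resp tr =
    <⇒≱ (+-monoʳ-< ∣ T ∣ ≤-refl) (≤-trans k≥ (traceable⇒labels≤∣T∣+1 H resp tr))

  addEdge-traceable⇒labels≤∣T∣+2 : (G : Graph n) → RespectsLabels G ℓ →
    {u v : Fin n} (u≢v : u ≢ v) → Traceable (addEdge G u v u≢v) → k ≤ ∣ T ∣ + 2
  addEdge-traceable⇒labels≤∣T∣+2 G resp {u} {v} u≢v (p , p-inj , p-adj) =
    ≤-trans (labels≤1+∣T∣+changes p-inj (λ _ _ → zero) changesAtSameStep)
            (≤-reflexive (sym (+-suc ∣ T ∣ 1)))
    where
    onNewEdge : ∀ {q} ((j , _) : ChangeAt p q) → SamePair (p q) (p j) u v
    onNewEdge {q} (j , s , ch) = addEdge-labelChange G ℓ resp u≢v (p-adj q j s) ch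
    changesAtSameStep : ∀ {q q′} (ch : ChangeAt p q) (ch′ : ChangeAt p q′) → zero ≡ zero → q ≡ q′
    changesAtSameStep ch ch′ _ =
      injective-step-unique p-inj (proj₁ (proj₂ ch)) (proj₁ (proj₂ ch′)) (onNewEdge ch) (onNewEdge ch′)

module ComponentLabelling (G : Graph n) (T : Subset n) (c : (v : Fin n) → v ∉ T → Fin k)
                          (isLabelling : IsComponentLabelling G T k c) where

  private
    sameComponent : ∀ {u v} (u∉T : u ∉ T) (v∉T : v ∉ T) → Conn G (∁ T) u v → c u u∉T ≡ c v v∉T
    sameComponent u∉T v∉T = from (proj₂ isLabelling _ _ u∉T v∉T)

    c-irrelevant : ∀ {v} (h h′ : v ∉ T) → c v h ≡ c v h′
    c-irrelevant h h′ = sameComponent h h′ (here (x∉p⇒x∈∁p h))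

  label : Fin n → Maybe (Fin k)
  label v with v ∈? T
  ... | yes _ = nothing
  ... | no v∉T = just (c v v∉T)

  label-nothing⇒∈ : ∀ {v} → label v ≡ nothing → v ∈ T
  label-nothing⇒∈ {v} _ with v ∈? T
  label-nothing⇒∈ _ | yes v∈T = v∈T
  label-nothing⇒∈ () | no _

  label-just⇒ : ∀ {v i} → label v ≡ just i → Σ (v ∉ T) λ v∉T → c v v∉T ≡ i
  label-just⇒ {v} _ with v ∈? T
  label-just⇒ () | yes _
  label-just⇒ e | no v∉T = v∉T , just-injective e

  label-∉ : ∀ {v} (v∉T : v ∉ T) → label v ≡ just (c v v∉T)
  label-∉ {v} v∉T with v ∈? T
  ... | yes v∈T = ⊥-elim (v∉T v∈T)
  ... | no v∉T′ = cong just (c-irrelevant v∉T′ v∉T)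

  label-surjective : ∀ i → ∃ λ v → label v ≡ just i
  label-surjective i =
    let v , v∉T , cv≡i = proj₁ isLabelling i in v , trans (label-∉ v∉T) (cong just cv≡i)

  label-respects : RespectsLabels G label
  label-respects a (i , j , ℓx≡i , ℓy≡j , i≢j) =
    let x∉T , cx≡i = label-just⇒ ℓx≡i
        y∉T , cy≡j = label-just⇒ ℓy≡j
        x~y = step (x∉p⇒x∈∁p x∉T) a (here (x∉p⇒x∈∁p y∉T))
    in i≢j (trans (sym cx≡i) (trans (sameComponent x∉T y∉T x~y) cy≡j))

  label-T∪A : ∀ {x i j} → (x ∈ T ⊎ Σ (x ∉ T) λ x∉T → c x x∉T ≡ i) → label x ≡ just j → j ≡ i
  label-T∪A x∈T∪A ℓx≡j with label-just⇒ ℓx≡j | x∈T∪A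
  ... | x∉T , _ | inj₁ x∈T = ⊥-elim (x∉T x∈T)
  ... | x∉T , cx≡j | inj₂ (x∉T′ , cx≡i) = trans (sym cx≡j) (trans (c-irrelevant x∉T x∉T′) cx≡i)

¬Adj⇒adj≡false : (G : Graph n) {x y : Fin n} → ¬ Adj G x y → adj G x y ≡ false
¬Adj⇒adj≡false _ ¬a = ¬-not (¬a ∘ from T-≡)

module _ (G : Graph n) {T : Subset n} {u v : Fin n} (u∉T : u ∉ T) (v∉T : v ∉ T)
         (u≁v : ¬ Conn G (∁ T) u v) where

  disconnected⇒≢ : u ≢ v
  disconnected⇒≢ refl = u≁v (here (x∉p⇒x∈∁p u∉T))

  disconnected⇒adj≡false : adj G u v ≡ false
  disconnected⇒adj≡false = ¬Adj⇒adj≡false G λ a → u≁v (step (x∉p⇒x∈∁p u∉T) a (here (x∉p⇒x∈∁p v∉T)))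

lemma3 : ∀ {n} (G : Graph n) (T' : Subset n) → Connected G → Cutset G T'
    → (k : ℕ) (c : (v : Fin n) → v ∉ T' → Fin k) → IsComponentLabelling G T' k c
    → (k ≥ ∣ T' ∣ + 2 → ¬ Traceable G)
      × (MaximalNontraceable G → k ≤ ∣ T' ∣ + 2)
      × (MaximalNontraceable G → k ≡ ∣ T' ∣ + 2
          → ∀ (i : Fin k) (x y : Fin n) → x ≢ y
          → (x ∈ T' ⊎ Σ (x ∉ T') λ hx → c x hx ≡ i)
          → (y ∈ T' ⊎ Σ (y ∉ T') λ hy → c y hy ≡ i)
          → Adj G x y)
lemma3 G T' _ (u , v , u∉T , v∉T , u≁v) k c isLabelling =
  (λ k≥ → labels≥∣T∣+2⇒¬traceable k≥ G label-respects) ,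
  (λ (_ , maximal) → addEdge-traceable⇒labels≤∣T∣+2 G label-respects u≢v
                        (maximal u v u≢v (disconnected⇒adj≡false G u∉T v∉T u≁v))) ,
  λ (_ , maximal) k≡ i x y x≢y x∈T∪Aᵢ y∈T∪Aᵢ → decidable-stable (T? (adj G x y)) λ x≁y →
    labels≥∣T∣+2⇒¬traceable (≤-reflexive (sym k≡)) (addEdge G x y x≢y)
      (addEdge-respectsLabels G label label-respects x≢y i (label-T∪A x∈T∪Aᵢ) (label-T∪A y∈T∪Aᵢ))
      (maximal x y x≢y (¬Adj⇒adj≡false G x≁y))
  where
  open ComponentLabelling G T' c isLabelling
  open LabelCount T' label label-nothing⇒∈ label-surjective

  u≢v : u ≢ v
  u≢v = disconnected⇒≢ G u∉T v∉T u≁v
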